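{- Let $\Pi:\mathsf{S}_k\to\{0,1\}$ and $\gamma,\delta>0$. For all sufficiently large $n$ the following holds: let $\Psi$ be a $\textsf{Max-OCSP}(\Pi)$ instance on $n$ variables whose constraint hypergraph is a $(\gamma,\delta)$-small partition hypergraph expander (with respect to $q$-partitions), let $\Phi$ be the $q$-coarsening of $\Psi$, and suppose $q\ge\frac{2}{\gamma}$. Then $\textsf{val}_\Psi\le\overline{\textsf{val}}^q_\Phi+\delta$.
   Context: Notation: $[n]=\{0,\ldots,n-1\}$, $\mathsf{S}_n$ the bijections of $[n]$; for distinct integers, $\textsf{ord}(a_0,\ldots,a_{k-1})$ is the unique $\boldsymbol{\tau}\in\mathsf{S}_k$ with $a_{\boldsymbol{\tau}(0)}<\cdots<a_{\boldsymbol{\tau}(k-1)}$. An instance $\Psi$ of $\textsf{Max-OCSP}(\Pi)$ on $n$ variables is a list of $m\ge1$ constraints, each a $k$-tuple $\mathbf{j}=(j_0,\ldots,j_{k-1})$ of distinct elements of $[n]$; $\boldsymbol{\sigma}\in\mathsf{S}_n$ satisfies $\mathbf{j}$ if $\Pi(\textsf{ord}(\boldsymbol{\sigma}(j_0),\ldots,\boldsymbol{\sigma}(j_{k-1})))=1$; $\textsf{val}_\Psi$ is the max over $\boldsymbol{\sigma}$ of the fraction of satisfied constraints. The constraint hypergraph of $\Psi$ is the $k$-hypergraph on $[n]$ whose hyperedges are the constraint tuples (with multiplicity). For $\mathbf{b}\in[q]^n$ and $\mathbf{j}$, $\mathbf{b}|_{\mathbf{j}}=(b_{j_0},\ldots,b_{j_{k-1}})$.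 The $q$-coarsening of $\Psi$ is the instance $\Phi$ with the same constraints of $\textsf{Max-CSP}(f^q_\Pi)$, where $f^q_\Pi(\mathbf{a})=1$ iff the entries of $\mathbf{a}\in[q]^k$ are distinct and $\Pi(\textsf{ord}(\mathbf{a}))=1$; $\overline{\textsf{val}}^q_\Phi=\max_{\mathbf{b}\in[q]^n}$ of the fraction of constraints $\mathbf{j}$ with $f^q_\Pi(\mathbf{b}|_{\mathbf{j}})=1$. A hyperedge lies on $S$ if at least two of its (distinct) vertices are in $S$. $\mathbf{b}\in[q]^n$ is viewed as a partition into blocks $\mathbf{b}^{ -1}(i)$; a hyperedge congregates on $\mathbf{b}$ if it lies on some block. A $k$-hypergraph $G=(V,E)$ is a $(\gamma,\delta)$-small partition hypergraph expander if for every $\mathbf{b}\in[q]^n$ all of whose blocks have size at most $\gamma|V|$, at most $\delta|E|$ hyperedges congregate on $\mathbf{b}$. -}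

module Defs where

open import Data.Nat as ℕ using (ℕ; zero; suc; _<ᵇ_)
open import Data.Bool using (Bool; true; false; _∧_; if_then_else_)
open import Data.Fin using (Fin; toℕ)
open import Data.Fin.Properties using (any?; all?)
open import Data.Vec using (Vec; lookup; tabulate)
open import Data.List using (List; []; _∷_; length; map)
open import Data.List.Membership.Propositional using (_∈_)
open import Data.Fin.Permutation using (Permutation′; _⟨$⟩ʳ_)
open import Data.Integer using (+_)
open import Data.Rational using (ℚ; _/_; _≤_; _+_; _*_)
open import Data.Product using (_,_; ∃; _×_)
open import Relation.Nullary using (yes; no; ¬_; Dec)
open import Relation.Nullary.Decidable using (isYes; _→-dec_; ¬?; _×-dec_)
open import Relation.Binary.PropositionalEquality using (_≡_; _≢_)

ℕ→ℚ : ℕ → ℚ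
ℕ→ℚ n = (+ n) / 1

countB : {A : Set} → (A → Bool) → List A → ℕ
countB p [] = 0
countB p (x ∷ xs) = if p x then suc (countB p xs) else countB p xs

allFinL : (n : ℕ) → List (Fin n)
allFinL n = Data.List.tabulate (λ i → i)

-- S_k is represented by the vector (τ(0), …, τ(k-1)) of a permutation τ.
-- A predicate Π : S_k → {0,1} is a function Vec (Fin k) k → Bool
-- (its values on non-permutation vectors are never used).
Pred-Sk : ℕ → Set
Pred-Sk k = Vec (Fin k) k → Bool

rank : {k : ℕ} → (Fin k → ℕ) → Fin k → ℕ
rank {k} a i = countB (λ j → a j <ᵇ a i) (allFinL k)

-- ord(a_0,…,a_{k-1}) : the τ with a_{τ(0)} < … < a_{τ(k-1)};
-- τ(r) is the (unique, for distinct entries) position of rank r.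
ord : {k : ℕ} → (Fin k → ℕ) → Vec (Fin k) k
ord {k} a = tabulate λ r → pick r (any? (λ i → rank a i ℕ.≟ toℕ r))
  where
  pick : (r : Fin k) → Dec (∃ λ i → rank a i ≡ toℕ r) → Fin k
  pick r (yes (i , _)) = i
  pick r (no _) = r

distinctB : {k : ℕ} → (Fin k → ℕ) → Bool
distinctB a = isYes (all? λ i → all? λ j → (a i ℕ.≟ a j) →-dec (i Data.Fin.≟ j))

Distinct : {n k : ℕ} → Vec (Fin n) k → Set
Distinct {k = k} j = (i i' : Fin k) → lookup j i ≡ lookup j i' → i ≡ i'

record Instance (n k : ℕ) : Set where
  field
    constraints : List (Vec (Fin n) k)
    nonempty    : constraints ≢ []
    distinct    : ∀ {j} → j ∈ constraints → Distinct j

open Instance public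

satOCSP : {n k : ℕ} → Pred-Sk k → Permutation′ n → Vec (Fin n) k → Bool
satOCSP Π σ j = Π (ord (λ i → toℕ (σ ⟨$⟩ʳ lookup j i)))

numSatOCSP : {n k : ℕ} → Pred-Sk k → Instance n k → Permutation′ n → ℕ
numSatOCSP Π Ψ σ = countB (satOCSP Π σ) (constraints Ψ)

fq : {k q : ℕ} → Pred-Sk k → (Fin k → Fin q) → Bool
fq Π a = distinctB (λ i → toℕ (a i)) ∧ Π (ord (λ i → toℕ (a i)))

-- number of constraints of the q-coarsening Φ of Ψ satisfied by b ∈ [q]^n
numSatCoarse : {n k q : ℕ} → Pred-Sk k → Instance n k → (Fin n → Fin q) → ℕ
numSatCoarse Π Ψ b = countB (λ j → fq Π (λ i → b (lookup j i))) (constraints Ψ)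

blockSize : {n q : ℕ} → (Fin n → Fin q) → Fin q → ℕ
blockSize {n} b c = countB (λ v → isYes (b v Data.Fin.≟ c)) (allFinL n)

congregates : {n k q : ℕ} → (Fin n → Fin q) → Vec (Fin n) k → Bool
congregates b j = isYes (any? λ i → any? λ i' →
  ¬? (lookup j i Data.Fin.≟ lookup j i') ×-dec (b (lookup j i) Data.Fin.≟ b (lookup j i')))

-- the k-hypergraph ([n], E) (E a list of hyperedges, with multiplicity) is a
-- (γ,δ)-small partition hypergraph expander w.r.t. q-partitions
SmallPartitionExpander : (n k q : ℕ) → ℚ → ℚ → List (Vec (Fin n) k) → Set
SmallPartitionExpander n k q γ δ E =
  (b : Fin n → Fin q) →
  ((c : Fin q) → ℕ→ℚ (blockSize b c) ≤ γ * ℕ→ℚ n) →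
  ℕ→ℚ (countB (congregates b) E) ≤ δ * ℕ→ℚ (length E)

-- Cut the order σ into q consecutive intervals of length s = ⌊n/q⌋ + 1 ≤ n/q + 1; as q ≥ 2/γ and
-- n ≥ 2/γ this is at most γn, so the expander hypothesis applies to the resulting partition b.
-- Since b is monotone along σ, on a constraint whose variables lie in pairwise distinct blocks b
-- induces the same ordering pattern as σ. Hence every constraint satisfied by σ is either
-- satisfied by b in the coarsening or congregates on b, and at most δm constraints congregate.
module Submission where

open import Defs
open import Data.Nat using (ℕ)
open import Data.Fin using (Fin)
open import Data.List using (length)
open import Data.Fin.Permutation using (Permutation′)
open import Data.Product using (∃; Σ)
open import Data.Rational using (ℚ; 0ℚ; _≤_; _<_; _+_; _*_; _÷_; >-nonZero)

open import Level using (0ℓ)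
open import Function using (_∘_; _⇔_; mk⇔; Equivalence)
open import Data.Bool using (Bool; true; false; T)
open import Data.Bool.Properties using (T-∧)
open import Data.Nat as ℕ using (zero; suc; pred; NonZero; _∸_; _<ᵇ_; z≤n; s≤s)
import Data.Nat.Properties as ℕP
open import Data.Nat.DivMod using (_/_; m≡m%n+[m/n]*n; m%n<n; m%n≤n; m/n*n≤m; m<n*o⇒m/o<n; /-monoˡ-≤)
open import Data.Nat.Coprimality using (Coprime; 1-coprimeTo) renaming (sym to coprime-sym)
open import Data.Nat.Tactic.RingSolver using (solve)
open import Data.Integer as ℤ using (+_; +[1+_]; -[1+_])
import Data.Integer.Properties as ℤP
open import Data.Rational as ℚ using (mkℚ; 1/_; toℚᵘ; *<*)
import Data.Rational.Properties as ℚP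
open import Data.Rational.Unnormalised as ℚᵘ using (mkℚᵘ; *≤*) renaming (_≤_ to _≤ᵘ_)
import Data.Rational.Unnormalised.Properties as ℚᵘP
open import Data.Fin as Fin using (toℕ; fromℕ<)
import Data.Fin.Properties as FinP
open import Data.Fin.Properties using (any?)
open import Data.Fin.Permutation using (_⟨$⟩ʳ_)
open import Data.Vec using (Vec; lookup)
open import Data.Vec.Properties using (tabulate-cong)
open import Data.List using ([]; _∷_; tabulate)
open import Data.List.Membership.Propositional using (_∈_)
open import Data.List.Relation.Unary.Any using (here; there)
open import Data.Maybe as Maybe using (Maybe; just; nothing)
import Data.Maybe.Properties as MaybeP
open import Data.Product as Product using (_,_; _×_)
open import Data.Sum using (_⊎_; inj₁; inj₂)
open import Relation.Nullary using (Dec; yes; no; contradiction)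
open import Relation.Nullary.Decidable using (T?; isYes; fromWitness; toWitness)
open import Relation.Nullary.Reflects using (det; fromEquivalence)
open import Relation.Unary using (Pred; Decidable)
open import Relation.Binary.PropositionalEquality
import Algebra.Properties.CommutativeMonoid.Sum as CommutativeMonoidSum
import Algebra.Properties.CommutativeSemigroup as CommutativeSemigroupProperties

open CommutativeMonoidSum ℕP.+-0-commutativeMonoid using (sum; sum-permute)
open CommutativeSemigroupProperties ℕP.+-commutativeSemigroup using (interchange)

Bool→ℕ : Bool → ℕ
Bool→ℕ true  = 1
Bool→ℕ false = 0

Bool→ℕ-⊎ : ∀ {a b c} → (T a → T b ⊎ T c) → Bool→ℕ a ℕ.≤ Bool→ℕ b ℕ.+ Bool→ℕ c
Bool→ℕ-⊎ {false}                 _ = z≤n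
Bool→ℕ-⊎ {true}  {true}          _ = s≤s z≤n
Bool→ℕ-⊎ {true}  {false} {true}  _ = s≤s z≤n
Bool→ℕ-⊎ {true}  {false} {false} h with h _
... | inj₁ ()
... | inj₂ ()

pred∸pred≤∸ : ∀ m n → pred m ∸ pred n ℕ.≤ m ∸ n
pred∸pred≤∸ m       zero    = ℕP.pred[n]≤n
pred∸pred≤∸ zero    (suc n) = ℕP.≤-reflexive (ℕP.0∸n≡0 n)
pred∸pred≤∸ (suc m) (suc n) = ℕP.≤-refl

pred-interval : ∀ {L U m} → L ℕ.≤ suc m × suc m ℕ.< U → pred L ℕ.≤ m × m ℕ.< pred U
pred-interval = Product.map ℕP.pred-mono-≤ ℕP.suc[m]≤n⇒m≤pred[n]

module _ {A : Set} where

  countB-∷ : ∀ (p : A → Bool) x xs → countB p (x ∷ xs) ≡ Bool→ℕ (p x) ℕ.+ countB p xs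
  countB-∷ p x xs with p x
  ... | true  = refl
  ... | false = refl

  countB-cong : ∀ {p p′ : A → Bool} xs → (∀ x → p x ≡ p′ x) → countB p xs ≡ countB p′ xs
  countB-cong []               _    = refl
  countB-cong {p} {p′} (x ∷ xs) p≗p′ = begin
    countB p (x ∷ xs)                   ≡⟨ countB-∷ p x xs ⟩
    Bool→ℕ (p x) ℕ.+ countB p xs       ≡⟨ cong₂ ℕ._+_ (cong Bool→ℕ (p≗p′ x)) (countB-cong xs p≗p′) ⟩
    Bool→ℕ (p′ x) ℕ.+ countB p′ xs     ≡⟨ countB-∷ p′ x xs ⟨
    countB p′ (x ∷ xs)                  ∎
    where open ≡-Reasoning

  countB-⊎ : ∀ (p q r : A → Bool) xs → (∀ {x} → x ∈ xs → T (p x) → T (q x) ⊎ T (r x)) →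
    countB p xs ℕ.≤ countB q xs ℕ.+ countB r xs
  countB-⊎ p q r []       _ = z≤n
  countB-⊎ p q r (x ∷ xs) h = begin
    countB p (x ∷ xs)
      ≡⟨ countB-∷ p x xs ⟩
    Bool→ℕ (p x) ℕ.+ countB p xs
      ≤⟨ ℕP.+-mono-≤ (Bool→ℕ-⊎ (h (here refl))) (countB-⊎ p q r xs (h ∘ there)) ⟩
    (Bool→ℕ (q x) ℕ.+ Bool→ℕ (r x)) ℕ.+ (countB q xs ℕ.+ countB r xs)
      ≡⟨ interchange (Bool→ℕ (q x)) (Bool→ℕ (r x)) (countB q xs) (countB r xs) ⟩
    (Bool→ℕ (q x) ℕ.+ countB q xs) ℕ.+ (Bool→ℕ (r x) ℕ.+ countB r xs)
      ≡⟨ cong₂ ℕ._+_ (countB-∷ q x xs) (countB-∷ r x xs) ⟨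
    countB q (x ∷ xs) ℕ.+ countB r (x ∷ xs)
      ∎
    where open ℕP.≤-Reasoning

  countB-tabulate : ∀ {n} (p : A → Bool) (f : Fin n → A) →
    countB p (tabulate f) ≡ sum (λ i → Bool→ℕ (p (f i)))
  countB-tabulate {zero}  p f = refl
  countB-tabulate {suc n} p f =
    trans (countB-∷ p (f Fin.zero) (tabulate (f ∘ Fin.suc)))
          (cong (Bool→ℕ (p (f Fin.zero)) ℕ.+_) (countB-tabulate p (f ∘ Fin.suc)))

  countB-tabulate-interval : ∀ {n} (p : A → Bool) (f : Fin n → A) {L U} →
    (∀ i → T (p (f i)) → L ℕ.≤ toℕ i × toℕ i ℕ.< U) → countB p (tabulate f) ℕ.≤ U ∸ L
  countB-tabulate-interval {zero}  p f         support = z≤n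
  countB-tabulate-interval {suc n} p f {L} {U} support with p (f Fin.zero) in eq
  ... | false = ℕP.≤-trans (countB-tabulate-interval p (f ∘ Fin.suc) (λ i → pred-interval ∘ support (Fin.suc i)))
                           (pred∸pred≤∸ U L)
  ... | true with support Fin.zero (subst T (sym eq) _)
  ...   | z≤n , s≤s _ =
    s≤s (countB-tabulate-interval p (f ∘ Fin.suc) (λ i → pred-interval ∘ support (Fin.suc i)))

countB-allFin-permute : ∀ {n} (p : Fin n → Bool) (π : Permutation′ n) →
  countB (p ∘ (π ⟨$⟩ʳ_)) (allFinL n) ≡ countB p (allFinL n)
countB-allFin-permute p π = begin
  countB (p ∘ (π ⟨$⟩ʳ_)) (allFinL _)   ≡⟨ countB-tabulate (p ∘ (π ⟨$⟩ʳ_)) (λ i → i) ⟩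
  sum (Bool→ℕ ∘ p ∘ (π ⟨$⟩ʳ_))         ≡⟨ sum-permute (Bool→ℕ ∘ p) π ⟨
  sum (Bool→ℕ ∘ p)                     ≡⟨ countB-tabulate p (λ i → i) ⟨
  countB p (allFinL _)                 ∎
  where open ≡-Reasoning

witness : ∀ {k} {P : Pred (Fin k) 0ℓ} → Dec (∃ P) → Maybe (Fin k)
witness (yes (i , _)) = just i
witness (no _)        = nothing

any?-witness-cong : ∀ {k} {P Q : Pred (Fin k) 0ℓ} (P? : Decidable P) (Q? : Decidable Q) →
  (∀ i → P i ⇔ Q i) → witness (any? P?) ≡ witness (any? Q?)
any?-witness-cong {zero}  P? Q? P⇔Q = refl
any?-witness-cong {suc k} P? Q? P⇔Q with P? Fin.zero | Q? Fin.zero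
... | yes _ | yes _ = refl
... | yes p | no ¬q = contradiction (Equivalence.to (P⇔Q Fin.zero) p) ¬q
... | no ¬p | yes q = contradiction (Equivalence.from (P⇔Q Fin.zero) q) ¬p
... | no _  | no _
  with any? (P? ∘ Fin.suc) | any? (Q? ∘ Fin.suc)
     | any?-witness-cong (P? ∘ Fin.suc) (Q? ∘ Fin.suc) (P⇔Q ∘ Fin.suc)
...   | yes _ | yes _ | eq = cong (Maybe.map Fin.suc) eq
...   | no _  | no _  | _  = refl
...   | yes _ | no _  | ()
...   | no _  | yes _ | ()

ord-cong : ∀ {k} {a b : Fin k → ℕ} → (∀ i j → (a j <ᵇ a i) ≡ (b j <ᵇ b i)) → ord a ≡ ord b
ord-cong {k} {a} {b} <ᵇ-eq = tabulate-cong pick-cong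
  where
  rank-eq : ∀ i → rank a i ≡ rank b i
  rank-eq i = countB-cong (allFinL k) (<ᵇ-eq i)
  -- The type mentions `pick`, which is local to the where-block of `ord`, so it cannot be written out.
  pick-cong : _
  pick-cong r with any? (λ i → rank a i ℕ.≟ toℕ r) | any? (λ i → rank b i ℕ.≟ toℕ r)
                 | any?-witness-cong (λ i → rank a i ℕ.≟ toℕ r) (λ i → rank b i ℕ.≟ toℕ r)
                     (λ i → mk⇔ (trans (sym (rank-eq i))) (trans (rank-eq i)))
  ... | yes _ | yes _ | eq = MaybeP.just-injective eq
  ... | no _  | no _  | _  = refl
  ... | yes _ | no _  | ()
  ... | no _  | yes _ | ()

<ᵇ-cong : ∀ {m n m′ n′} → (m ℕ.< n ⇔ m′ ℕ.< n′) → (m <ᵇ n) ≡ (m′ <ᵇ n′)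
<ᵇ-cong {m} {n} {m′} {n′} m<n⇔m′<n′ = det (ℕP.<ᵇ-reflects-< m n)
  (fromEquivalence (Equivalence.from m<n⇔m′<n′ ∘ ℕP.<ᵇ⇒< m′ n′) (ℕP.<⇒<ᵇ ∘ Equivalence.to m<n⇔m′<n′))

ord-monotone : ∀ {k} {a b : Fin k → ℕ} → (∀ i j → a i ℕ.≤ a j → b i ℕ.≤ b j) →
  (∀ i j → b i ≡ b j → i ≡ j) → ord a ≡ ord b
ord-monotone {a = a} {b} mono inj = ord-cong λ i j → <ᵇ-cong (mk⇔ (forth j i) (back j i))
  where
  forth : ∀ i j → a i ℕ.< a j → b i ℕ.< b j
  forth i j a<a = ℕP.≤∧≢⇒< (mono i j (ℕP.<⇒≤ a<a)) λ b≡b → ℕP.<-irrefl (cong a (inj i j b≡b)) a<a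
  back : ∀ i j → b i ℕ.< b j → a i ℕ.< a j
  back i j b<b = ℕP.≰⇒> λ a≥a → ℕP.<⇒≱ b<b (mono j i a≥a)

Coarsening : ∀ {n q} → Permutation′ n → (Fin n → Fin q) → Set
Coarsening σ b = ∀ u v → toℕ (σ ⟨$⟩ʳ u) ℕ.≤ toℕ (σ ⟨$⟩ʳ v) → toℕ (b u) ℕ.≤ toℕ (b v)

satOCSP⇒fq⊎congregates : ∀ {n k q} (Π : Pred-Sk k) {σ : Permutation′ n} {b : Fin n → Fin q}
  {j : Vec (Fin n) k} → Coarsening σ b → Distinct j → T (satOCSP Π σ j) →
  T (fq Π (λ i → b (lookup j i))) ⊎ T (congregates b j)
satOCSP⇒fq⊎congregates Π {σ} {b} {j} coarse distinct sat with T? (congregates b j)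
... | yes congregate = inj₂ congregate
... | no ¬congregate = inj₁ (Equivalence.from T-∧
  (fromWitness b∘j-injective ,
   subst (T ∘ Π) (ord-monotone (λ i i′ → coarse (lookup j i) (lookup j i′)) b∘j-injective) sat))
  where
  b∘j-injective : ∀ i i′ → toℕ (b (lookup j i)) ≡ toℕ (b (lookup j i′)) → i ≡ i′
  b∘j-injective i i′ eq with lookup j i Fin.≟ lookup j i′
  ... | yes j≡j = distinct i i′ j≡j
  ... | no  j≢j = contradiction (fromWitness (i , i′ , j≢j , FinP.toℕ-injective eq)) ¬congregate

numSatOCSP≤numSatCoarse+congregating : ∀ {n k q} (Π : Pred-Sk k) (Ψ : Instance n k)
  {σ : Permutation′ n} {b : Fin n → Fin q} → Coarsening σ b →
  numSatOCSP Π Ψ σ ℕ.≤ numSatCoarse Π Ψ b ℕ.+ countB (congregates b) (constraints Ψ)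
numSatOCSP≤numSatCoarse+congregating Π Ψ {σ} {b} coarse =
  countB-⊎ (satOCSP Π σ) (λ j → fq Π (λ i → b (lookup j i))) (congregates b) (constraints Ψ)
    λ {j} j∈Ψ → satOCSP⇒fq⊎congregates Π {σ} {b} {j} coarse (distinct Ψ j∈Ψ)

m/n≡o⇒o*n≤m<o*n+n : ∀ {m n o} .{{_ : NonZero n}} → m / n ≡ o → o ℕ.* n ℕ.≤ m × m ℕ.< o ℕ.* n ℕ.+ n
m/n≡o⇒o*n≤m<o*n+n {m} {n} refl =
  m/n*n≤m m n ,
  subst₂ ℕ._<_ (sym (m≡m%n+[m/n]*n m n)) (ℕP.+-comm n (m / n ℕ.* n))
    (ℕP.+-monoˡ-< (m / n ℕ.* n) (m%n<n m n))

blocks : ∀ {n q} s .{{_ : NonZero s}} → n ℕ.≤ s ℕ.* q → Fin n → Fin q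
blocks {n} {q} s n≤sq x =
  fromℕ< (m<n*o⇒m/o<n (ℕP.<-≤-trans (FinP.toℕ<n x) (subst (n ℕ.≤_) (ℕP.*-comm s q) n≤sq)))

toℕ-blocks : ∀ {n q} s .{{_ : NonZero s}} (n≤sq : n ℕ.≤ s ℕ.* q) x → toℕ (blocks s n≤sq x) ≡ toℕ x / s
toℕ-blocks s n≤sq x = FinP.toℕ-fromℕ< _

blockSize-blocks : ∀ {n q} s .{{_ : NonZero s}} (n≤sq : n ℕ.≤ s ℕ.* q) c →
  blockSize (blocks s n≤sq) c ℕ.≤ s
blockSize-blocks s n≤sq c = subst (blockSize (blocks s n≤sq) c ℕ.≤_) (ℕP.m+n∸m≡n (toℕ c ℕ.* s) s)
  (countB-tabulate-interval (λ x → isYes (blocks s n≤sq x Fin.≟ c)) (λ x → x) λ x x∈c →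
    m/n≡o⇒o*n≤m<o*n+n (trans (sym (toℕ-blocks s n≤sq x)) (cong toℕ (toWitness x∈c))))

small-block-coarsening : ∀ {n q} s .{{_ : NonZero s}} → n ℕ.≤ s ℕ.* q → (σ : Permutation′ n) →
  ∃ λ (b : Fin n → Fin q) → Coarsening σ b × (∀ c → blockSize b c ℕ.≤ s)
small-block-coarsening s n≤sq σ = blocks s n≤sq ∘ (σ ⟨$⟩ʳ_) , coarse , small
  where
  coarse : Coarsening σ (blocks s n≤sq ∘ (σ ⟨$⟩ʳ_))
  coarse u v σu≤σv =
    subst₂ ℕ._≤_ (sym (toℕ-blocks s n≤sq (σ ⟨$⟩ʳ u))) (sym (toℕ-blocks s n≤sq (σ ⟨$⟩ʳ v)))
      (/-monoˡ-≤ s σu≤σv)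
  small : ∀ c → blockSize (blocks s n≤sq ∘ (σ ⟨$⟩ʳ_)) c ℕ.≤ s
  small c = subst (ℕ._≤ s) (sym (countB-allFin-permute (λ x → isYes (blocks s n≤sq x Fin.≟ c)) σ))
    (blockSize-blocks s n≤sq c)

m≤[1+m/n]*n : ∀ m n .{{_ : NonZero n}} → m ℕ.≤ suc (m / n) ℕ.* n
m≤[1+m/n]*n m n = subst₂ ℕ._≤_ (sym (m≡m%n+[m/n]*n m n)) refl (ℕP.+-monoˡ-≤ (m / n ℕ.* n) (m%n≤n m n))

[1+t]*D≤A*m : ∀ {m q t A D} .{{_ : NonZero A}} →
  t ℕ.* q ℕ.≤ m → 2 ℕ.* D ℕ.≤ m → 2 ℕ.* D ℕ.≤ A ℕ.* q → suc t ℕ.* D ℕ.≤ A ℕ.* m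
[1+t]*D≤A*m {m} {q} {t} {A} {D} tq≤m 2D≤m 2D≤Aq = ℕP.*-cancelˡ-≤ 2 (begin
  2 ℕ.* (suc t ℕ.* D)            ≡⟨ solve (t ∷ D ∷ []) ⟩
  2 ℕ.* D ℕ.+ t ℕ.* (2 ℕ.* D)    ≤⟨ ℕP.+-mono-≤ 2D≤m (ℕP.*-monoʳ-≤ t 2D≤Aq) ⟩
  m ℕ.+ t ℕ.* (A ℕ.* q)          ≡⟨ cong (m ℕ.+_) (solve (t ∷ A ∷ q ∷ [])) ⟩
  m ℕ.+ A ℕ.* (t ℕ.* q)          ≤⟨ ℕP.+-mono-≤ (ℕP.m≤n*m m A) (ℕP.*-monoʳ-≤ A tq≤m) ⟩
  A ℕ.* m ℕ.+ A ℕ.* m            ≡⟨ solve (A ∷ m ∷ []) ⟩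
  2 ℕ.* (A ℕ.* m)                ∎)
  where open ℕP.≤-Reasoning

∃-block-length : ∀ {m q A D} .{{_ : NonZero A}} .{{_ : NonZero D}} →
  2 ℕ.* D ℕ.≤ m → 2 ℕ.* D ℕ.≤ A ℕ.* q →
  ∃ λ t → m ℕ.≤ suc t ℕ.* q × suc t ℕ.* D ℕ.≤ A ℕ.* m
∃-block-length {q = zero} {A} {D} _ 2D≤A*0 = contradiction
  (ℕP.n≤0⇒n≡0 (subst (2 ℕ.* D ℕ.≤_) (ℕP.*-zeroʳ A) 2D≤A*0)) (ℕ.≢-nonZero⁻¹ (2 ℕ.* D) {{ℕP.m*n≢0 2 D}})
∃-block-length {m} {q@(suc _)} 2D≤m 2D≤Aq =
  m / q , m≤[1+m/n]*n m q , [1+t]*D≤A*m {t = m / q} (m/n*n≤m m q) 2D≤m 2D≤Aq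

ℕ→ℚ≡mkℚ : ∀ n → ℕ→ℚ n ≡ mkℚ (+ n) 0 (coprime-sym (1-coprimeTo n))
ℕ→ℚ≡mkℚ n = ℚP.normalize-coprime (coprime-sym (1-coprimeTo n))

toℚᵘ-ℕ→ℚ : ∀ n → toℚᵘ (ℕ→ℚ n) ≡ mkℚᵘ (+ n) 0
toℚᵘ-ℕ→ℚ n = cong toℚᵘ (ℕ→ℚ≡mkℚ n)

ℕ→ℚ-homo-+ : ∀ m n → ℕ→ℚ (m ℕ.+ n) ≡ ℕ→ℚ m + ℕ→ℚ n
ℕ→ℚ-homo-+ m n rewrite ℕ→ℚ≡mkℚ m | ℕ→ℚ≡mkℚ n | ℤP.*-identityʳ (+ m) | ℤP.*-identityʳ (+ n) = refl

mkℚᵘ-≤⁺ : ∀ {m d n e} → m ℕ.* suc e ℕ.≤ n ℕ.* suc d → mkℚᵘ (+ m) d ≤ᵘ mkℚᵘ (+ n) e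
mkℚᵘ-≤⁺ {m} {d} {n} {e} h = *≤* (subst₂ ℤ._≤_ (ℤP.pos-* m (suc e)) (ℤP.pos-* n (suc d)) (ℤ.+≤+ h))

mkℚᵘ-≤⁻ : ∀ {m d n e} → mkℚᵘ (+ m) d ≤ᵘ mkℚᵘ (+ n) e → m ℕ.* suc e ℕ.≤ n ℕ.* suc d
mkℚᵘ-≤⁻ {m} {d} {n} {e} (*≤* h) =
  ℤP.drop‿+≤+ (subst₂ ℤ._≤_ (sym (ℤP.pos-* m (suc e))) (sym (ℤP.pos-* n (suc d))) h)

ℕ→ℚ-mono-≤ : ∀ {m n} → m ℕ.≤ n → ℕ→ℚ m ≤ ℕ→ℚ n
ℕ→ℚ-mono-≤ {m} {n} m≤n = ℚP.toℚᵘ-cancel-≤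
  (subst₂ _≤ᵘ_ (sym (toℚᵘ-ℕ→ℚ m)) (sym (toℚᵘ-ℕ→ℚ n)) (mkℚᵘ-≤⁺ (ℕP.*-monoˡ-≤ 1 m≤n)))

ℕ→ℚ≤fraction*ℕ→ℚ : ∀ {a d} .{c : Coprime (suc a) (suc d)} {m n} →
  m ℕ.* suc d ℕ.≤ suc a ℕ.* n → ℕ→ℚ m ≤ mkℚ +[1+ a ] d c * ℕ→ℚ n
ℕ→ℚ≤fraction*ℕ→ℚ {a} {d} {c} {m} {n} h =
  ℚP.toℚᵘ-cancel-≤ (ℚᵘP.≤-respʳ-≃ (ℚᵘP.≃-sym (ℚP.toℚᵘ-homo-* (mkℚ +[1+ a ] d c) (ℕ→ℚ n))) le)
  where
  le : toℚᵘ (ℕ→ℚ m) ≤ᵘ mkℚᵘ +[1+ a ] d ℚᵘ.* toℚᵘ (ℕ→ℚ n)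
  le rewrite toℚᵘ-ℕ→ℚ m | toℚᵘ-ℕ→ℚ n | ℕP.*-identityʳ d | sym (ℤP.pos-* (suc a) n) =
    mkℚᵘ-≤⁺ (subst (m ℕ.* suc d ℕ.≤_) (sym (ℕP.*-identityʳ (suc a ℕ.* n))) h)

ℕ→ℚ÷fraction≤ℕ→ℚ⇒ : ∀ {a d} .{c : Coprime (suc a) (suc d)} {m n} →
  ℕ→ℚ m ÷ mkℚ +[1+ a ] d c ≤ ℕ→ℚ n → m ℕ.* suc d ℕ.≤ suc a ℕ.* n
ℕ→ℚ÷fraction≤ℕ→ℚ⇒ {a} {d} {c} {m} {n} h =
  subst₂ ℕ._≤_ (ℕP.*-identityʳ (m ℕ.* suc d)) (ℕP.*-comm n (suc a)) (mkℚᵘ-≤⁻ le)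
  where
  normalise : toℚᵘ (ℕ→ℚ m) ℚᵘ.* mkℚᵘ +[1+ d ] a ≤ᵘ toℚᵘ (ℕ→ℚ n) →
    mkℚᵘ (+ (m ℕ.* suc d)) a ≤ᵘ mkℚᵘ (+ n) 0
  normalise le rewrite toℚᵘ-ℕ→ℚ m | toℚᵘ-ℕ→ℚ n | ℕP.+-identityʳ a | sym (ℤP.pos-* m (suc d)) = le
  le : mkℚᵘ (+ (m ℕ.* suc d)) a ≤ᵘ mkℚᵘ (+ n) 0
  le = normalise (ℚᵘP.≤-respˡ-≃ (ℚP.toℚᵘ-homo-* (ℕ→ℚ m) (1/ mkℚ +[1+ a ] d c)) (ℚP.toℚᵘ-mono-≤ h))

numSatOCSP≤numSatCoarse+δm : ∀ {n k q} (Π : Pred-Sk k) (Ψ : Instance n k) {γ δ : ℚ}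
  {σ : Permutation′ n} {b : Fin n → Fin q} → SmallPartitionExpander n k q γ δ (constraints Ψ) →
  Coarsening σ b → (∀ c → ℕ→ℚ (blockSize b c) ≤ γ * ℕ→ℚ n) →
  ℕ→ℚ (numSatOCSP Π Ψ σ) ≤ ℕ→ℚ (numSatCoarse Π Ψ b) + δ * ℕ→ℚ (length (constraints Ψ))
numSatOCSP≤numSatCoarse+δm Π Ψ {δ = δ} {σ} {b} expander coarse small = begin
  ℕ→ℚ (numSatOCSP Π Ψ σ)
    ≤⟨ ℕ→ℚ-mono-≤ (numSatOCSP≤numSatCoarse+congregating Π Ψ {σ} {b} coarse) ⟩
  ℕ→ℚ (satisfied ℕ.+ congregating)
    ≡⟨ ℕ→ℚ-homo-+ satisfied congregating ⟩
  ℕ→ℚ satisfied + ℕ→ℚ congregating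
    ≤⟨ ℚP.+-monoʳ-≤ (ℕ→ℚ satisfied) (expander b small) ⟩
  ℕ→ℚ satisfied + δ * ℕ→ℚ (length (constraints Ψ))
    ∎
  where
  satisfied = numSatCoarse Π Ψ b
  congregating = countB (congregates b) (constraints Ψ)
  open ℚP.≤-Reasoning

lemma4p8 : (k : ℕ) (Π : Pred-Sk k) (γ δ : ℚ) (γ>0 : 0ℚ < γ) → 0ℚ < δ →
    ∃ λ (N : ℕ) → (n : ℕ) → N Data.Nat.≤ n → (q : ℕ) (Ψ : Instance n k) →
    SmallPartitionExpander n k q γ δ (constraints Ψ) →
    _÷_ (ℕ→ℚ 2) γ {{>-nonZero γ>0}} ≤ ℕ→ℚ q →
    (σ : Permutation′ n) → ∃ λ (b : Fin n → Fin q) →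
    ℕ→ℚ (numSatOCSP Π Ψ σ) ≤ ℕ→ℚ (numSatCoarse Π Ψ b) + δ * ℕ→ℚ (length (constraints Ψ))
lemma4p8 _ _ (mkℚ (+ zero)  _ _) _ (*<* (ℤ.+<+ ())) _
lemma4p8 _ _ (mkℚ -[1+ _ ] _ _) _ (*<* ())          _
-- With γ = (1+a)/(1+d), the bound n ≥ N = 2(1+d) gives n ≥ 2/γ.
lemma4p8 k Π (mkℚ +[1+ a ] d c) δ _ _ = 2 ℕ.* suc d , λ n 2D≤n q Ψ expander 2/γ≤q σ →
  let t , n≤sq , sD≤An = ∃-block-length {n} {q} {suc a} {suc d} 2D≤n
                             (ℕ→ℚ÷fraction≤ℕ→ℚ⇒ {a} {d} {c} {2} {q} 2/γ≤q)
      b , coarse , small = small-block-coarsening (suc t) n≤sq σ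
  in b , numSatOCSP≤numSatCoarse+δm Π Ψ {mkℚ +[1+ a ] d c} {δ} {σ} {b} expander coarse
           λ block → ℚP.≤-trans (ℕ→ℚ-mono-≤ (small block))
                                (ℕ→ℚ≤fraction*ℕ→ℚ {a} {d} {c} {suc t} {n} sD≤An)
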